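{- Let $G$ be a $4$-edge-connected graph with $\beta\in Z(G,\mathbb{Z}_3)$, and let $x,y$ be a pair of vertices joined by a set $E(x,y)$ of at least $3$ parallel edges. Let $G'=G/E(x,y)$ (i.e. $G$ with $x$ and $y$ identified into a vertex $w$ and loops deleted), and let $\beta'$ be defined by $\beta'(v)=\beta(v)$ for $v\in V(G)\setminus\{x,y\}$ and $\beta'(w)\equiv\beta(x)+\beta(y)\pmod 3$. If $G'$ has a strongly-connected $\beta'$-orientation $D'$, then $D'$ can be extended to a strongly-connected $\beta$-orientation $D$ of $G$.
   Context: Graphs may have parallel edges but no loops. $Z(G,\mathbb{Z}_3)$ is the set of $\beta:V(G)\to\mathbb{Z}_3$ with $\sum_v\beta(v)\equiv 0\pmod 3$; for such $\beta$, a $\beta$-orientation is an orientation $D$ of $G$ with $d^+_D(v)-d^-_D(v)\equiv\beta(v)\pmod 3$ for every vertex $v$. Extension means $D$ agrees with $D'$ on all edges of $G$ other than those between $x$ and $y$. -}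

module Defs where

open import Data.Nat using (ℕ; zero; suc; _+_; _≤_)
open import Data.Integer as ℤ using (ℤ; +_)
open import Data.Integer.Divisibility using () renaming (_∣_ to _∣ℤ_)
open import Data.Nat.Divisibility using (_∣_)
open import Data.Nat.DivMod using (_mod_)
open import Data.Fin using (Fin; zero; suc; toℕ; punchOut; punchIn; _≟_)
open import Data.Bool using (Bool; true; false; if_then_else_; _∧_; _∨_; _xor_; not)
open import Data.Product using (_×_; _,_; proj₁; proj₂; ∃)
open import Data.List using (List; []; _∷_; length; lookup)
open import Relation.Nullary using (yes; no; ¬_)
open import Relation.Nullary.Decidable using (⌊_⌋)
open import Relation.Binary.PropositionalEquality using (_≡_; _≢_; sym)
open import Function using (_∘_)

-- A multigraph on vertex set Fin n with edge set Fin m: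
-- each edge e has two (unordered) ends; parallel edges allowed.
Graph : ℕ → ℕ → Set
Graph n m = Fin m → Fin n × Fin n

Loopless : ∀ {n m} → Graph n m → Set
Loopless G = ∀ e → proj₁ (G e) ≢ proj₂ (G e)

count : ∀ {m} → (Fin m → Bool) → ℕ
count {zero}  P = 0
count {suc m} P = (if P zero then 1 else 0) + count (P ∘ suc)

sumℕ : ∀ {n} → (Fin n → ℕ) → ℕ
sumℕ {zero}  f = 0
sumℕ {suc n} f = f zero + sumℕ (f ∘ suc)

-- An orientation assigns to each edge a direction:
-- true = from proj₁ to proj₂, false = from proj₂ to proj₁.
Orientation : ℕ → Set
Orientation m = Fin m → Bool

module _ {n m : ℕ} (G : Graph n m) (D : Orientation m) where
  tail head : Fin m → Fin n
  tail e = if D e then proj₁ (G e) else proj₂ (G e)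
  head e = if D e then proj₂ (G e) else proj₁ (G e)

  outdeg indeg : Fin n → ℕ
  outdeg v = count (λ e → ⌊ tail e ≟ v ⌋)
  indeg  v = count (λ e → ⌊ head e ≟ v ⌋)

  data Reach : Fin n → Fin n → Set where
    here : ∀ {u} → Reach u u
    step : ∀ {u v} (e : Fin m) → tail e ≡ u → Reach (head e) v → Reach u v

  StronglyConnected : Set
  StronglyConnected = ∀ u v → Reach u v

  IsBetaOrientation : (Fin n → Fin 3) → Set
  IsBetaOrientation β =
    ∀ v → (+ 3) ∣ℤ ((+ outdeg v ℤ.- + indeg v) ℤ.- + toℕ (β v))

InZ3 : ∀ {n} → (Fin n → Fin 3) → Set
InZ3 β = 3 ∣ sumℕ (λ v → toℕ (β v))

cutSize : ∀ {n m} → Graph n m → (Fin n → Bool) → ℕ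
cutSize G S = count (λ e → S (proj₁ (G e)) xor S (proj₂ (G e)))

EdgeConnected : ∀ {n m} → ℕ → Graph n m → Set
EdgeConnected k G =
  ∀ (S : Fin _ → Bool) → ∃ (λ u → S u ≡ true) → ∃ (λ v → S v ≡ false) →
  k ≤ cutSize G S

isXY : ∀ {n m} → Graph n m → Fin n → Fin n → Fin m → Bool
isXY G x y e =
  (⌊ proj₁ (G e) ≟ x ⌋ ∧ ⌊ proj₂ (G e) ≟ y ⌋) ∨
  (⌊ proj₁ (G e) ≟ y ⌋ ∧ ⌊ proj₂ (G e) ≟ x ⌋)

-- Contraction G / E(x,y), for G on Fin (suc k) vertices and x ≢ y.
-- Vertices of G/E(x,y): Fin k, obtained from Fin (suc k) by removing y
-- (punchOut); x becomes the merged vertex w.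

module Contraction {k m : ℕ} (G : Graph (suc k) m) (x y : Fin (suc k)) (x≢y : x ≢ y) where

  π : Fin (suc k) → Fin k
  π v with v ≟ y
  ... | yes _  = punchOut {i = y} {j = x} (x≢y ∘ sym)
  ... | no v≢y = punchOut {i = y} {j = v} (v≢y ∘ sym)

  w : Fin k
  w = π x

  keep : ∀ {m'} → (Fin m' → Bool) → List (Fin m')
  keep {zero}  P = []
  keep {suc m'} P =
    if P zero then zero ∷ Data.List.map suc (keep (P ∘ suc))
    else Data.List.map suc (keep (P ∘ suc))

  others : List (Fin m)
  others = keep (λ e → not (isXY G x y e))

  m' : ℕ
  m' = length others

  ι : Fin m' → Fin m
  ι = lookup others

  G' : Graph k m'
  G' e' = π (proj₁ (G (ι e'))) , π (proj₂ (G (ι e')))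

  β' : (Fin (suc k) → Fin 3) → Fin k → Fin 3
  β' β v with v ≟ w
  ... | yes _ = (toℕ (β x) + toℕ (β y)) mod 3
  ... | no _  = β (punchIn y v)

module Submission where

-- Let H = G − E(x,y) on V(G).  Its edges are those of G', so D' orients H and
-- an extension only has to orient the t ≥ 3 edges of E(x,y): p of them from x
-- to y and t − p from y to x.  Away from x and y the degrees are those of D';
-- at x the β-condition fixes p modulo 3; at y it then follows from the
-- condition of D' at the merged vertex w.  Strong connectivity needs only
-- walks x → y and y → x, since every walk of G' lifts.  If p ∈ {1, 2} both
-- directions occur in E(x,y); if p ≡ 0 we take p = 0 or p = 3 according to a
-- walk of H between x and y, and if H has none, the vertices reachable from x
-- in H are cut off by E(x,y) alone, so 4-edge-connectivity gives t ≥ 4.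

open import Data.Nat.DivMod using (_mod_; m≡m%n+[m/n]*n; m%n<n)
import Data.Integer.DivMod as ℤ
open import Data.Nat as ℕ using (ℕ; zero; suc; _+_; _*_; _≤_; _<_; z≤n; s≤s; _⊓_; pred)
open import Data.Nat.Properties using (module ≤-Reasoning; +-assoc; ≤-refl; ≤-trans; m≤n⇒m≤1+n; n≤1+n; +-suc; +-identityʳ; ⊓-zeroʳ; m≤n⇒m⊓n≡m; <-irrefl)
open import Data.Nat.Tactic.RingSolver using (solve-∀)
open import Data.Integer as ℤ using (ℤ; +_)
import Data.Integer.Properties as ℤ
import Data.Integer.Tactic.RingSolver as ℤ-Solver
open import Data.Integer.Divisibility.Signed using (divides; ∣m∣n⇒∣m-n; ∣⇒∣ᵤ; ∣ᵤ⇒∣) renaming (_∣_ to _∣ₛ_)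
open import Data.Fin using (Fin; zero; suc; _≟_; toℕ)
open import Data.Fin.Properties using (toℕ-fromℕ<; any?; all?; ¬∀⟶∃¬; suc-injective; punchOut-cong; punchOut-injective; punchIn-punchOut)
import Data.Bool.Properties as Bool
open import Data.Bool using (Bool; true; false; if_then_else_; _∧_; _∨_; not; _xor_)
open import Data.Product using (Σ; _×_; _,_; proj₁; proj₂; ∃)
open import Data.Sum using (_⊎_; inj₁; inj₂)
open import Relation.Nullary using (Dec; does; yes; no; ¬_; contradiction)
open import Relation.Nullary.Decidable using (⌊_⌋; dec-true; dec-false; _×-dec_; _→-dec_)
open import Relation.Binary.PropositionalEquality using (_≡_; _≢_; refl; sym; trans; cong; cong₂; subst; module ≡-Reasoning)
open import Data.List using (List; []; _∷_; length; lookup; map)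
open import Data.List.Relation.Unary.All as All using (All; []; _∷_)
import Data.List.Relation.Unary.All.Properties as All
open import Data.List.Relation.Unary.AllPairs using ([]; _∷_)
open import Data.List.Relation.Unary.Unique.Propositional using (Unique)
import Data.List.Relation.Unary.Unique.Propositional.Properties as Unique
open import Data.List.Membership.Propositional.Properties using (∈-lookup)
open import Function using (_∘_)
open import Defs

≟-sound : ∀ {n} {a b : Fin n} → ⌊ a ≟ b ⌋ ≡ true → a ≡ b
≟-sound {a = a} {b} h with a ≟ b
... | yes a≡b = a≡b

≟-refl : ∀ {n} (a : Fin n) → ⌊ a ≟ a ⌋ ≡ true
≟-refl a with a ≟ a
... | yes _   = refl
... | no a≢a = contradiction refl a≢a

≟-≢ : ∀ {n} {a b : Fin n} → a ≢ b → ⌊ a ≟ b ⌋ ≡ false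
≟-≢ {a = a} {b} a≢b with a ≟ b
... | yes a≡b = contradiction a≡b a≢b
... | no _    = refl

∧-elim : ∀ {a b : Bool} → a ∧ b ≡ true → a ≡ true × b ≡ true
∧-elim {true} {true} _ = refl , refl

if-true : ∀ {A : Set} {b : Bool} {p q : A} → b ≡ true → (if b then p else q) ≡ p
if-true refl = refl

if-false : ∀ {A : Set} {b : Bool} {p q : A} → not b ≡ true → (if b then p else q) ≡ q
if-false {b = false} _ = refl

does-agree : ∀ {A B : Set} (a? : Dec A) (b? : Dec B) → (A → B) → (B → A) → does a? ≡ does b?
does-agree (yes _) (yes _) _   _   = refl
does-agree (no _)  (no _)  _   _   = refl
does-agree (yes a) (no ¬b) a→b _   = contradiction (a→b a) ¬b
does-agree (no ¬a) (yes b) _   b→a = contradiction (b→a b) ¬a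

xor-ends : ∀ {n} (S : Fin n → Bool) b (p q : Fin n) →
           S (if b then p else q) ≡ S (if b then q else p) → (S p xor S q) ≡ false
xor-ends S true  p q same rewrite same = Bool.xor-same (S q)
xor-ends S false p q same rewrite same = Bool.xor-same (S p)

indicator : Bool → ℕ
indicator b = if b then 1 else 0

count-ext : ∀ {m} {f g : Fin m → Bool} → (∀ e → f e ≡ g e) → count f ≡ count g
count-ext {zero}  f≗g = refl
count-ext {suc m} f≗g rewrite f≗g zero = cong (_+_ _) (count-ext (f≗g ∘ suc))

count-none : ∀ {m} (f : Fin m → Bool) → (∀ e → f e ≡ false) → count f ≡ 0
count-none {zero}  f none = refl
count-none {suc m} f none rewrite none zero = count-none (f ∘ suc) (none ∘ suc)

count-≤ : ∀ {m} (f : Fin m → Bool) → count f ≤ m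
count-≤ {zero}  f = z≤n
count-≤ {suc m} f with f zero
... | true  = s≤s (count-≤ (f ∘ suc))
... | false = m≤n⇒m≤1+n (count-≤ (f ∘ suc))

count-≤-ind : ∀ {m} (b : Bool) (g : Fin m → Bool) → count g ≤ indicator b + count g
count-≤-ind true  g = n≤1+n _
count-≤-ind false g = ≤-refl

count-mono : ∀ {m} (f g : Fin m → Bool) → (∀ e → f e ≡ true → g e ≡ true) → count f ≤ count g
count-mono {zero}  f g f⊆g = z≤n
count-mono {suc m} f g f⊆g with f zero in f0
... | true rewrite f⊆g zero f0 = s≤s (count-mono (f ∘ suc) (g ∘ suc) (f⊆g ∘ suc))
... | false = ≤-trans (count-mono (f ∘ suc) (g ∘ suc) (f⊆g ∘ suc)) (count-≤-ind (g zero) (g ∘ suc))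

count-strict : ∀ {m} (f g : Fin m → Bool) → (∀ e → f e ≡ true → g e ≡ true) →
               ∀ e → f e ≡ false → g e ≡ true → suc (count f) ≤ count g
count-strict {suc m} f g f⊆g zero fe ge rewrite fe | ge = s≤s (count-mono (f ∘ suc) (g ∘ suc) (f⊆g ∘ suc))
count-strict {suc m} f g f⊆g (suc e) fe ge with f zero in f0
... | true rewrite f⊆g zero f0 = s≤s (count-strict (f ∘ suc) (g ∘ suc) (f⊆g ∘ suc) e fe ge)
... | false = ≤-trans (count-strict (f ∘ suc) (g ∘ suc) (f⊆g ∘ suc) e fe ge) (count-≤-ind (g zero) (g ∘ suc))

count-witness : ∀ {m} (f : Fin m → Bool) → 1 ≤ count f → ∃ λ e → f e ≡ true
count-witness {suc m} f pos with f zero in f0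
... | true  = zero , f0
... | false with count-witness (f ∘ suc) pos
...   | e , fe = suc e , fe

count-split : ∀ {m} (f g : Fin m → Bool) → count (λ e → f e ∧ g e) + count (λ e → f e ∧ not (g e)) ≡ count f
count-split {zero}  f g = refl
count-split {suc m} f g with f zero | g zero
... | true  | true  = cong suc (count-split (f ∘ suc) (g ∘ suc))
... | true  | false = trans (+-suc _ _) (cong suc (count-split (f ∘ suc) (g ∘ suc)))
... | false | _     = count-split (f ∘ suc) (g ∘ suc)

count-∨ : ∀ {m} (f g : Fin m → Bool) → (∀ e → f e ≡ true → g e ≡ false) →
          count (λ e → f e ∨ g e) ≡ count f + count g
count-∨ {zero}  f g disj = refl
count-∨ {suc m} f g disj with f zero in f0
... | true rewrite disj zero f0 = cong suc (count-∨ (f ∘ suc) (g ∘ suc) (disj ∘ suc))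
... | false with g zero
...   | true  = trans (cong suc (count-∨ (f ∘ suc) (g ∘ suc) (disj ∘ suc))) (sym (+-suc _ _))
...   | false = count-∨ (f ∘ suc) (g ∘ suc) (disj ∘ suc)

-- The first j elements satisfying P; exactly min j (count P) of them exist.
firstOf : ∀ {m} → ℕ → (Fin m → Bool) → Fin m → Bool
firstOf zero    P zero    = false
firstOf (suc j) P zero    = true
firstOf j       P (suc e) = firstOf (if P zero then pred j else j) (P ∘ suc) e

count-firstOf : ∀ {m} j (P : Fin m → Bool) → count (λ e → P e ∧ firstOf j P e) ≡ j ⊓ count P
count-firstOf {zero}  j       P = sym (⊓-zeroʳ j)
count-firstOf {suc m} zero    P with P zero
... | true  = count-firstOf zero (P ∘ suc)
... | false = count-firstOf zero (P ∘ suc)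
count-firstOf {suc m} (suc j) P with P zero
... | true  = cong suc (count-firstOf j (P ∘ suc))
... | false = count-firstOf (suc j) (P ∘ suc)

Reach-trans : ∀ {n m} {G : Graph n m} {D : Orientation m} {a b c} →
              Reach G D a b → Reach G D b c → Reach G D a c
Reach-trans here          q = q
Reach-trans (step e t r) q = step e t (Reach-trans r q)

Reach-snoc : ∀ {n m} {G : Graph n m} {D : Orientation m} {a} e →
             Reach G D a (tail G D e) → Reach G D a (head G D e)
Reach-snoc e r = Reach-trans r (step e refl here)

edge-walk : ∀ {n m} {G : Graph n m} {D : Orientation m} e {a b} →
            tail G D e ≡ a → head G D e ≡ b → Reach G D a b
edge-walk {G = G} {D} e t h = step e t (subst (λ c → Reach G D c _) (sym h) here)

module _ {n m m'} (G : Graph n m) (ι : Fin m' → Fin m) {D : Orientation m} {D' : Orientation m'}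
         (agree : ∀ e' → D (ι e') ≡ D' e') where

  tail-sub : ∀ e' → tail G D (ι e') ≡ tail (G ∘ ι) D' e'
  tail-sub e' = cong (λ b → if b then proj₁ (G (ι e')) else proj₂ (G (ι e'))) (agree e')

  head-sub : ∀ e' → head G D (ι e') ≡ head (G ∘ ι) D' e'
  head-sub e' = cong (λ b → if b then proj₂ (G (ι e')) else proj₁ (G (ι e'))) (agree e')

  Reach-sub : ∀ {u v} → Reach (G ∘ ι) D' u v → Reach G D u v
  Reach-sub here           = here
  Reach-sub (step e' t r) =
    step (ι e') (trans (tail-sub e') t) (subst (λ a → Reach G D a _) (sym (head-sub e')) (Reach-sub r))

mapVertices : ∀ {n n' m} → (Fin n → Fin n') → Graph n m → Graph n' m
mapVertices f H e = f (proj₁ (H e)) , f (proj₂ (H e))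

tail-map : ∀ {n n' m} (f : Fin n → Fin n') (H : Graph n m) (D : Orientation m) e →
           tail (mapVertices f H) D e ≡ f (tail H D e)
tail-map f H D e with D e
... | true  = refl
... | false = refl

head-map : ∀ {n n' m} (f : Fin n → Fin n') (H : Graph n m) (D : Orientation m) e →
           head (mapVertices f H) D e ≡ f (head H D e)
head-map f H D e with D e
... | true  = refl
... | false = refl

toward : ∀ {n m} (G : Graph n m) (D : Orientation m) e {a b} → a ≢ b →
         G e ≡ (a , b) ⊎ G e ≡ (b , a) → D e ≡ ⌊ proj₁ (G e) ≟ a ⌋ → tail G D e ≡ a × head G D e ≡ b
toward G D e {a} a≢b (inj₁ ends) De rewrite De | ends | ≟-refl a = refl , refl
toward G D e a≢b (inj₂ ends) De rewrite De | ends | ≟-≢ (a≢b ∘ sym) = refl , refl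

-- Reachability in a finite oriented graph is decidable: the sets of vertices
-- reachable within i steps grow strictly until one of them is closed under
-- out-going edges, which happens after at most n rounds.
module Reachability {n m} (G : Graph n m) (D : Orientation m) where

  Closed : (Fin n → Bool) → Set
  Closed S = ∀ e → S (tail G D e) ≡ true → S (head G D e) ≡ true

  closed? : ∀ S → Dec (Closed S)
  closed? S = all? (λ e → (S (tail G D e) Bool.≟ true) →-dec (S (head G D e) Bool.≟ true))

  closed-reach : ∀ S → Closed S → ∀ {u v} → S u ≡ true → Reach G D u v → S v ≡ true
  closed-reach S closed Su here         = Su
  closed-reach S closed Su (step e t r) = closed-reach S closed (closed e (subst (λ a → S a ≡ true) (sym t) Su)) r

  leaving : ∀ S → ¬ Closed S → ∃ λ e → S (tail G D e) ≡ true × S (head G D e) ≡ false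
  leaving S open' with ¬∀⟶∃¬ m _ (λ e → (S (tail G D e) Bool.≟ true) →-dec (S (head G D e) Bool.≟ true)) open'
  ... | e , ¬kept with S (tail G D e) in inside | S (head G D e) in outside
  ...   | true  | true  = contradiction (λ _ → refl) ¬kept
  ...   | true  | false = e , inside , outside
  ...   | false | _     = contradiction (λ ()) ¬kept

  within : Fin n → ℕ → Fin n → Bool
  within s zero    v = ⌊ v ≟ s ⌋
  within s (suc i) v = within s i v ∨ does (any? (λ e → (within s i (tail G D e) Bool.≟ true) ×-dec (head G D e ≟ v)))

  within-sound : ∀ s i v → within s i v ≡ true → Reach G D s v
  within-sound s zero    v h = subst (Reach G D s) (sym (≟-sound h)) here
  within-sound s (suc i) v h with within s i v in old | any? (λ e → (within s i (tail G D e) Bool.≟ true) ×-dec (head G D e ≟ v))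
  ... | true  | _                      = within-sound s i v old
  ... | false | yes (e , new , refl) = Reach-snoc e (within-sound s i (tail G D e) new)

  within-grow : ∀ s i v → within s i v ≡ true → within s (suc i) v ≡ true
  within-grow s i v h rewrite h = refl

  within-source : ∀ s i → within s i s ≡ true
  within-source s zero    = ≟-refl s
  within-source s (suc i) = within-grow s i s (within-source s i)

  within-step : ∀ s i e → within s i (tail G D e) ≡ true → within s (suc i) (head G D e) ≡ true
  within-step s i e h
    rewrite dec-true (any? (λ e' → (within s i (tail G D e') Bool.≟ true) ×-dec (head G D e' ≟ head G D e))) (e , h , refl)
    = Bool.∨-zeroʳ _

  within-strict : ∀ s i → ¬ Closed (within s i) → suc (count (within s i)) ≤ count (within s (suc i))
  within-strict s i open' with leaving (within s i) open'
  ... | e , inside , outside =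
    count-strict (within s i) (within s (suc i)) (within-grow s i) (head G D e) outside (within-step s i e inside)

  within-closes : ∀ s i → (∃ λ j → Closed (within s j)) ⊎ i ≤ count (within s i)
  within-closes s zero    = inj₂ z≤n
  within-closes s (suc i) with within-closes s i | closed? (within s i)
  ... | inj₁ closed | _           = inj₁ closed
  ... | inj₂ _      | yes closed  = inj₁ (i , closed)
  ... | inj₂ i≤     | no open'    = inj₂ (≤-trans (s≤s i≤) (within-strict s i open'))

  within-closed : ∀ s → ∃ λ j → Closed (within s j)
  within-closed s with within-closes s (suc n)
  ... | inj₁ closed = closed
  ... | inj₂ n<     = contradiction (≤-trans n< (count-≤ (within s (suc n)))) (<-irrefl refl)

  Reach? : ∀ s v → Dec (Reach G D s v)
  Reach? s v with within-closed s
  ... | j , closed with within s j v in reached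
  ...   | true  = yes (within-sound s j v reached)
  ...   | false = no λ r → contradiction (trans (sym (closed-reach (within s j) closed (within-source s j) r)) reached) λ ()

extendAlong : ∀ {m} (l : List (Fin m)) → (Fin (length l) → Bool) → Fin m → Bool
extendAlong []      f e = false
extendAlong (a ∷ l) f e = if ⌊ e ≟ a ⌋ then f zero else extendAlong l (f ∘ suc) e

extendAlong-lookup : ∀ {m} {l : List (Fin m)} (f : Fin (length l) → Bool) → Unique l →
                     ∀ i → extendAlong l f (lookup l i) ≡ f i
extendAlong-lookup {l = a ∷ l} f (_ ∷ _) zero rewrite ≟-refl a = refl
extendAlong-lookup {l = a ∷ l} f (a∉l ∷ unique) (suc i)
  rewrite ≟-≢ (All.lookup a∉l (∈-lookup i) ∘ sym) = extendAlong-lookup (f ∘ suc) unique i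

countList : ∀ {m} → (Fin m → Bool) → List (Fin m) → ℕ
countList Q []      = 0
countList Q (a ∷ l) = indicator (Q a) + countList Q l

countList-lookup : ∀ {m} (Q : Fin m → Bool) (l : List (Fin m)) → count (Q ∘ lookup l) ≡ countList Q l
countList-lookup Q []      = refl
countList-lookup Q (a ∷ l) = cong (_+_ _) (countList-lookup Q l)

countList-map-suc : ∀ {m} (Q : Fin (suc m) → Bool) (l : List (Fin m)) →
                    countList Q (map suc l) ≡ countList (Q ∘ suc) l
countList-map-suc Q []      = refl
countList-map-suc Q (a ∷ l) = cong (_+_ _) (countList-map-suc Q l)

+-exchange : ∀ a b c → a + (b + c) ≡ b + (a + c)
+-exchange = solve-∀

+-interchange : ∀ a b c d → (a + c) + (b + d) ≡ (a + b) + (c + d)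
+-interchange = solve-∀

module Keep {k m} (G : Graph (suc k) m) (x y : Fin (suc k)) (x≢y : x ≢ y) where
  open Contraction G x y x≢y using (keep)

  keep-all : ∀ {m'} (P : Fin m' → Bool) → All (λ e → P e ≡ true) (keep P)
  keep-all {zero}   P = []
  keep-all {suc m'} P with P zero in P0
  ... | true  = P0 ∷ All.map⁺ (keep-all (P ∘ suc))
  ... | false = All.map⁺ (keep-all (P ∘ suc))

  keep-unique : ∀ {m'} (P : Fin m' → Bool) → Unique (keep P)
  keep-unique {zero}   P = []
  keep-unique {suc m'} P with P zero
  ... | true  = All.map⁺ (All.tabulate (λ _ ())) ∷ Unique.map⁺ suc-injective (keep-unique (P ∘ suc))
  ... | false = Unique.map⁺ suc-injective (keep-unique (P ∘ suc))

  count-keep : ∀ {m'} (P Q : Fin m' → Bool) →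
               count Q ≡ countList Q (keep P) + count (λ e → not (P e) ∧ Q e)

  count-keep-suc : ∀ {m'} (P Q : Fin (suc m') → Bool) →
                   count (Q ∘ suc) ≡ countList Q (map suc (keep (P ∘ suc))) + count (λ e → not (P (suc e)) ∧ Q (suc e))
  count-keep-suc P Q =
    trans (count-keep (P ∘ suc) (Q ∘ suc)) (cong (_+ _) (sym (countList-map-suc Q (keep (P ∘ suc)))))

  count-keep {zero}   P Q = refl
  count-keep {suc m'} P Q with P zero
  ... | true  = trans (cong (_+_ (indicator (Q zero))) (count-keep-suc P Q)) (sym (+-assoc (indicator (Q zero)) _ _))
  ... | false = trans (cong (_+_ (indicator (Q zero))) (count-keep-suc P Q))
                      (+-exchange (indicator (Q zero)) (countList Q (map suc (keep (P ∘ suc)))) _)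

module Merging {k m} (G : Graph (suc k) m) (x y : Fin (suc k)) (x≢y : x ≢ y) where
  open Contraction G x y x≢y

  Merged : Fin (suc k) → Set
  Merged a = a ≡ x ⊎ a ≡ y

  π-y : π y ≡ w
  π-y with y ≟ y | x ≟ y
  ... | yes _   | yes x≡y = contradiction x≡y x≢y
  ... | yes _   | no _    = punchOut-cong y refl
  ... | no y≢y | _       = contradiction refl y≢y

  π-fibre : ∀ a b → π a ≡ π b → a ≡ b ⊎ (Merged a × Merged b)
  π-fibre a b πa≡πb with a ≟ y | b ≟ y
  ... | yes a≡y | yes b≡y = inj₁ (trans a≡y (sym b≡y))
  ... | yes a≡y | no b≢y  =
    inj₂ (inj₂ a≡y , inj₁ (sym (punchOut-injective (x≢y ∘ sym) (b≢y ∘ sym) πa≡πb)))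
  ... | no a≢y  | yes b≡y =
    inj₂ (inj₁ (sym (punchOut-injective (x≢y ∘ sym) (a≢y ∘ sym) (sym πa≡πb))) , inj₂ b≡y)
  ... | no a≢y  | no b≢y  = inj₁ (punchOut-injective (a≢y ∘ sym) (b≢y ∘ sym) πa≡πb)

  π-≟-unmerged : ∀ a {v} → v ≢ x → v ≢ y → ⌊ π a ≟ π v ⌋ ≡ ⌊ a ≟ v ⌋
  π-≟-unmerged a {v} v≢x v≢y with a ≟ v | π a ≟ π v
  ... | yes _   | yes _    = refl
  ... | yes a≡v | no πa≢πv = contradiction (cong π a≡v) πa≢πv
  ... | no a≢v  | no _     = refl
  ... | no a≢v  | yes πa≡πv with π-fibre a v πa≡πv
  ...   | inj₁ a≡v               = contradiction a≡v a≢v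
  ...   | inj₂ (_ , inj₁ v≡x)    = contradiction v≡x v≢x
  ...   | inj₂ (_ , inj₂ v≡y)    = contradiction v≡y v≢y

  π-unmerged : ∀ {v} → v ≢ x → v ≢ y → π v ≢ w
  π-unmerged v≢x v≢y πv≡w with π-fibre _ x πv≡w
  ... | inj₁ v≡x            = v≢x v≡x
  ... | inj₂ (inj₁ v≡x , _) = v≢x v≡x
  ... | inj₂ (inj₂ v≡y , _) = v≢y v≡y

  π-≟-w : ∀ a → ⌊ π a ≟ w ⌋ ≡ ⌊ a ≟ x ⌋ ∨ ⌊ a ≟ y ⌋
  π-≟-w a = fibre (a ≟ x) (a ≟ y)
    where
    fibre : (a≟x : Dec (a ≡ x)) (a≟y : Dec (a ≡ y)) → ⌊ π a ≟ w ⌋ ≡ ⌊ a≟x ⌋ ∨ ⌊ a≟y ⌋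
    fibre (yes a≡x) _         = subst (λ b → ⌊ π b ≟ w ⌋ ≡ true) (sym a≡x) (≟-refl w)
    fibre (no _)    (yes a≡y) =
      subst (λ b → ⌊ π b ≟ w ⌋ ≡ true) (sym a≡y) (subst (λ b → ⌊ b ≟ w ⌋ ≡ true) (sym π-y) (≟-refl w))
    fibre (no a≢x)  (no a≢y)  = ≟-≢ (π-unmerged a≢x a≢y)

  β'-unmerged : ∀ β {v} → v ≢ x → v ≢ y → β' β (π v) ≡ β v
  β'-unmerged β {v} v≢x v≢y with π v ≟ w
  ... | yes πv≡w = contradiction πv≡w (π-unmerged v≢x v≢y)
  ... | no _ with v ≟ y
  ...   | yes v≡y = contradiction v≡y v≢y
  ...   | no _    = cong β (punchIn-punchOut _)

  β'-w : ∀ β → β' β w ≡ (toℕ (β x) + toℕ (β y)) mod 3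
  β'-w β with w ≟ w
  ... | yes _   = refl
  ... | no w≢w = contradiction refl w≢w

net : ∀ {n m} → Graph n m → Orientation m → Fin n → ℤ
net G D v = + outdeg G D v ℤ.- + indeg G D v

net-sum : ∀ (ox oy ix iy O I t : ℕ) → ox + oy ≡ O + t → ix + iy ≡ I + t →
          (+ ox ℤ.- + ix) ℤ.+ (+ oy ℤ.- + iy) ≡ + O ℤ.- + I
net-sum ox oy ix iy O I t out-sum in-sum = begin
  (+ ox ℤ.- + ix) ℤ.+ (+ oy ℤ.- + iy)   ≡⟨ regroup (+ ox) (+ oy) (+ ix) (+ iy) ⟩
  + (ox + oy) ℤ.- + (ix + iy)             ≡⟨ cong₂ (λ a b → + a ℤ.- + b) out-sum in-sum ⟩
  + (O + t) ℤ.- + (I + t)                 ≡⟨ cancel (+ O) (+ I) (+ t) ⟩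
  + O ℤ.- + I                             ∎
  where
  open ≡-Reasoning
  regroup : ∀ a b c d → (a ℤ.- c) ℤ.+ (b ℤ.- d) ≡ (a ℤ.+ b) ℤ.- (c ℤ.+ d)
  regroup = ℤ-Solver.solve-∀
  cancel : ∀ a b c → (a ℤ.+ c) ℤ.- (b ℤ.+ c) ≡ a ℤ.- b
  cancel = ℤ-Solver.solve-∀

-- Balance at x.  Writing A = o − i − b − (p + q), if p ≡ A (mod 3) then
-- (o + p) − (i + q) − b = A + 2p ≡ 3A ≡ 0 (mod 3).
balance-x : ∀ (o i b p q c r s : ℤ) → o ℤ.- i ℤ.- b ℤ.- (p ℤ.+ q) ≡ c ℤ.+ r ℤ.* + 3 → p ≡ c ℤ.+ s ℤ.* + 3 →
            (o ℤ.+ p) ℤ.- (i ℤ.+ q) ℤ.- b ≡ (c ℤ.+ r ℤ.+ s ℤ.* + 2) ℤ.* + 3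
balance-x o i b .(c ℤ.+ s ℤ.* + 3) q c r s A≡ refl = begin
  (o ℤ.+ p) ℤ.- (i ℤ.+ q) ℤ.- b                ≡⟨ add-twice-p o i b p q ⟩
  (o ℤ.- i ℤ.- b ℤ.- (p ℤ.+ q)) ℤ.+ p ℤ.* + 2  ≡⟨ cong (ℤ._+ p ℤ.* + 2) A≡ ⟩
  (c ℤ.+ r ℤ.* + 3) ℤ.+ p ℤ.* + 2              ≡⟨ collect c r s ⟩
  (c ℤ.+ r ℤ.+ s ℤ.* + 2) ℤ.* + 3              ∎
  where
  open ≡-Reasoning
  p = c ℤ.+ s ℤ.* + 3
  add-twice-p : ∀ o i b p q → (o ℤ.+ p) ℤ.- (i ℤ.+ q) ℤ.- b ≡ (o ℤ.- i ℤ.- b ℤ.- (p ℤ.+ q)) ℤ.+ p ℤ.* + 2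
  add-twice-p = ℤ-Solver.solve-∀
  collect : ∀ c r s → (c ℤ.+ r ℤ.* + 3) ℤ.+ (c ℤ.+ s ℤ.* + 3) ℤ.* + 2 ≡ (c ℤ.+ r ℤ.+ s ℤ.* + 2) ℤ.* + 3
  collect = ℤ-Solver.solve-∀

-- Balance at y from balance at x and at the merged vertex: if
-- nx + ny = nw and bx + by = M + 3e, then ny − by = (nw − M) − (nx − bx) − 3e.
balance-y : ∀ (nx ny nw bx by M e : ℤ) → nx ℤ.+ ny ≡ nw → M ℤ.+ e ℤ.* + 3 ≡ bx ℤ.+ by →
            + 3 ∣ₛ nw ℤ.- M → + 3 ∣ₛ nx ℤ.- bx → + 3 ∣ₛ ny ℤ.- by
balance-y nx ny .(nx ℤ.+ ny) bx by M e refl M≡ 3∣w 3∣x =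
  subst (+ 3 ∣ₛ_) (sym ny-by) (∣m∣n⇒∣m-n (∣m∣n⇒∣m-n 3∣w 3∣x) (divides e refl))
  where
  open ≡-Reasoning
  R : ℤ
  R = (nx ℤ.+ ny ℤ.- M) ℤ.- (nx ℤ.- bx) ℤ.- e ℤ.* + 3
  ny-by : ny ℤ.- by ≡ R
  ny-by = begin
    ny ℤ.- by                                          ≡⟨ split nx ny bx by M e ⟩
    R ℤ.+ ((M ℤ.+ e ℤ.* + 3) ℤ.- (bx ℤ.+ by))          ≡⟨ cong (λ d → R ℤ.+ (d ℤ.- (bx ℤ.+ by))) M≡ ⟩
    R ℤ.+ ((bx ℤ.+ by) ℤ.- (bx ℤ.+ by))                ≡⟨ cong (ℤ._+_ R) (ℤ.+-inverseʳ (bx ℤ.+ by)) ⟩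
    R ℤ.+ + 0                                          ≡⟨ ℤ.+-identityʳ R ⟩
    R                                                  ∎
    where
    split : ∀ nx ny bx by M e → ny ℤ.- by ≡
            (nx ℤ.+ ny ℤ.- M) ℤ.- (nx ℤ.- bx) ℤ.- e ℤ.* + 3 ℤ.+ ((M ℤ.+ e ℤ.* + 3) ℤ.- (bx ℤ.+ by))
    split = ℤ-Solver.solve-∀

-- The edges of G' are
-- the edges ι e' of H = G − E(x,y), so an orientation D of G extends D' when
-- D ∘ ι = D'; such a D is determined by D' and its values on E(x,y).
module Extension {k m} (G : Graph (suc k) m) (x y : Fin (suc k)) (x≢y : x ≢ y)
                 (D' : Orientation (Contraction.m' G x y x≢y)) where
  open Contraction G x y x≢y
  open Keep G x y x≢y
  open Merging G x y x≢y

  XY : Fin m → Bool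
  XY = isXY G x y

  H : Graph (suc k) m'
  H = G ∘ ι

  Extends : Orientation m → Set
  Extends D = ∀ e' → D (ι e') ≡ D' e'

  ι-not-XY : ∀ e' → XY (ι e') ≡ false
  ι-not-XY e' = trans (sym (Bool.not-involutive _)) (cong not (All.lookup (keep-all (not ∘ XY)) (∈-lookup e')))

  count-H+XY : ∀ (Q : Fin m → Bool) → count Q ≡ count (Q ∘ ι) + count (λ e → XY e ∧ Q e)
  count-H+XY Q = begin
    count Q                                                ≡⟨ count-keep (not ∘ XY) Q ⟩
    countList Q others + count (λ e → not (not (XY e)) ∧ Q e) ≡⟨ cong₂ _+_ (sym (countList-lookup Q others))
                                                                 (count-ext (λ e → cong (_∧ Q e) (Bool.not-involutive (XY e)))) ⟩
    count (Q ∘ ι) + count (λ e → XY e ∧ Q e)              ∎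
    where open ≡-Reasoning

  outdeg-H+XY : ∀ {D} → Extends D → ∀ v → outdeg G D v ≡ outdeg H D' v + count (λ e → XY e ∧ ⌊ tail G D e ≟ v ⌋)
  outdeg-H+XY {D} ext v =
    trans (count-H+XY (λ e → ⌊ tail G D e ≟ v ⌋))
          (cong (_+ count (λ e → XY e ∧ ⌊ tail G D e ≟ v ⌋)) (count-ext (λ e' → cong (λ a → ⌊ a ≟ v ⌋) (tail-sub G ι {D} ext e'))))

  indeg-H+XY : ∀ {D} → Extends D → ∀ v → indeg G D v ≡ indeg H D' v + count (λ e → XY e ∧ ⌊ head G D e ≟ v ⌋)
  indeg-H+XY {D} ext v =
    trans (count-H+XY (λ e → ⌊ head G D e ≟ v ⌋))
          (cong (_+ count (λ e → XY e ∧ ⌊ head G D e ≟ v ⌋)) (count-ext (λ e' → cong (λ a → ⌊ a ≟ v ⌋) (head-sub G ι {D} ext e'))))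

  count-π-unmerged : ∀ (end : Fin m' → Fin (suc k)) {v} → v ≢ x → v ≢ y →
                     count (λ e' → ⌊ π (end e') ≟ π v ⌋) ≡ count (λ e' → ⌊ end e' ≟ v ⌋)
  count-π-unmerged end v≢x v≢y = count-ext (λ e' → π-≟-unmerged (end e') v≢x v≢y)

  count-π-w : ∀ (end : Fin m' → Fin (suc k)) →
              count (λ e' → ⌊ π (end e') ≟ w ⌋) ≡ count (λ e' → ⌊ end e' ≟ x ⌋) + count (λ e' → ⌊ end e' ≟ y ⌋)
  count-π-w end = trans (count-ext (λ e' → π-≟-w (end e'))) (count-∨ _ _ (λ e' → x-not-y (end e')))
    where x-not-y : ∀ a → ⌊ a ≟ x ⌋ ≡ true → ⌊ a ≟ y ⌋ ≡ false
          x-not-y a a≟x = ≟-≢ (λ a≡y → x≢y (trans (sym (≟-sound a≟x)) a≡y))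

  outdeg'-unmerged : ∀ {v} → v ≢ x → v ≢ y → outdeg G' D' (π v) ≡ outdeg H D' v
  outdeg'-unmerged v≢x v≢y =
    trans (count-ext (λ e' → cong (λ a → ⌊ a ≟ _ ⌋) (tail-map π H D' e'))) (count-π-unmerged (tail H D') v≢x v≢y)

  indeg'-unmerged : ∀ {v} → v ≢ x → v ≢ y → indeg G' D' (π v) ≡ indeg H D' v
  indeg'-unmerged v≢x v≢y =
    trans (count-ext (λ e' → cong (λ a → ⌊ a ≟ _ ⌋) (head-map π H D' e'))) (count-π-unmerged (head H D') v≢x v≢y)

  outdeg'-w : outdeg G' D' w ≡ outdeg H D' x + outdeg H D' y
  outdeg'-w = trans (count-ext (λ e' → cong (λ a → ⌊ a ≟ w ⌋) (tail-map π H D' e'))) (count-π-w (tail H D'))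

  indeg'-w : indeg G' D' w ≡ indeg H D' x + indeg H D' y
  indeg'-w = trans (count-ext (λ e' → cong (λ a → ⌊ a ≟ w ⌋) (head-map π H D' e'))) (count-π-w (head H D'))

  xy-ends : ∀ e → XY e ≡ true → G e ≡ (x , y) ⊎ G e ≡ (y , x)
  xy-ends e h with proj₁ (G e) ≟ x | proj₂ (G e) ≟ y | proj₁ (G e) ≟ y | proj₂ (G e) ≟ x
  ... | yes p | yes q | _     | _     = inj₁ (cong₂ _,_ p q)
  ... | _     | _     | yes p | yes q = inj₂ (cong₂ _,_ p q)
  xy-ends e () | no _  | _     | no _  | _
  xy-ends e () | no _  | _     | yes _ | no _
  xy-ends e () | yes _ | no _  | no _  | _
  xy-ends e () | yes _ | no _  | yes _ | no _

  tail-XY : ∀ D e → XY e ≡ true → Merged (tail G D e)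
  tail-XY D e h with xy-ends e h | D e
  ... | inj₁ ends | true  = inj₁ (cong proj₁ ends)
  ... | inj₁ ends | false = inj₂ (cong proj₂ ends)
  ... | inj₂ ends | true  = inj₂ (cong proj₁ ends)
  ... | inj₂ ends | false = inj₁ (cong proj₂ ends)

  head-XY : ∀ D e → XY e ≡ true → Merged (head G D e)
  head-XY D e h with xy-ends e h | D e
  ... | inj₁ ends | true  = inj₂ (cong proj₂ ends)
  ... | inj₁ ends | false = inj₁ (cong proj₁ ends)
  ... | inj₂ ends | true  = inj₁ (cong proj₂ ends)
  ... | inj₂ ends | false = inj₂ (cong proj₁ ends)

  count-on-XY : ∀ {f g : Fin m → Bool} → (∀ e → XY e ≡ true → f e ≡ g e) →
                count (λ e → XY e ∧ f e) ≡ count (λ e → XY e ∧ g e)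
  count-on-XY {f} {g} f≗g = count-ext pointwise
    where pointwise : ∀ e → (XY e ∧ f e) ≡ (XY e ∧ g e)
          pointwise e with XY e in h
          ... | true  = f≗g e h
          ... | false = refl

  count-XY-merged : ∀ (end : Fin m → Fin (suc k)) → (∀ e → XY e ≡ true → Merged (end e)) →
                    count (λ e → XY e ∧ ⌊ end e ≟ x ⌋) + count (λ e → XY e ∧ ⌊ end e ≟ y ⌋) ≡ count XY
  count-XY-merged end merged = begin
    count (λ e → XY e ∧ ⌊ end e ≟ x ⌋) + count (λ e → XY e ∧ ⌊ end e ≟ y ⌋)
      ≡⟨ sym (count-∨ _ _ disjoint) ⟩
    count (λ e → (XY e ∧ ⌊ end e ≟ x ⌋) ∨ (XY e ∧ ⌊ end e ≟ y ⌋))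
      ≡⟨ count-ext covered ⟩
    count XY ∎
    where
    open ≡-Reasoning
    disjoint : ∀ e → (XY e ∧ ⌊ end e ≟ x ⌋) ≡ true → (XY e ∧ ⌊ end e ≟ y ⌋) ≡ false
    disjoint e h with XY e | end e ≟ x
    ... | true | yes end≡x = ≟-≢ (λ end≡y → x≢y (trans (sym end≡x) end≡y))
    covered : ∀ e → ((XY e ∧ ⌊ end e ≟ x ⌋) ∨ (XY e ∧ ⌊ end e ≟ y ⌋)) ≡ XY e
    covered e with XY e in h
    ... | false = refl
    ... | true with merged e h
    ...   | inj₁ end≡x rewrite end≡x | ≟-refl x = refl
    ...   | inj₂ end≡y rewrite end≡y | ≟-refl y = Bool.∨-zeroʳ _

  outdeg-merged : ∀ {D} → Extends D → outdeg G D x + outdeg G D y ≡ outdeg G' D' w + count XY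
  outdeg-merged {D} ext = begin
    outdeg G D x + outdeg G D y                   ≡⟨ cong₂ _+_ (outdeg-H+XY ext x) (outdeg-H+XY ext y) ⟩
    (outdeg H D' x + out x) + (outdeg H D' y + out y) ≡⟨ +-interchange (outdeg H D' x) (outdeg H D' y) (out x) (out y) ⟩
    (outdeg H D' x + outdeg H D' y) + (out x + out y) ≡⟨ cong₂ _+_ (sym outdeg'-w) (count-XY-merged (tail G D) (tail-XY D)) ⟩
    outdeg G' D' w + count XY                     ∎
    where open ≡-Reasoning
          out : Fin (suc k) → ℕ
          out v = count (λ e → XY e ∧ ⌊ tail G D e ≟ v ⌋)

  indeg-merged : ∀ {D} → Extends D → indeg G D x + indeg G D y ≡ indeg G' D' w + count XY
  indeg-merged {D} ext = begin
    indeg G D x + indeg G D y                     ≡⟨ cong₂ _+_ (indeg-H+XY ext x) (indeg-H+XY ext y) ⟩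
    (indeg H D' x + into x) + (indeg H D' y + into y) ≡⟨ +-interchange (indeg H D' x) (indeg H D' y) (into x) (into y) ⟩
    (indeg H D' x + indeg H D' y) + (into x + into y) ≡⟨ cong₂ _+_ (sym indeg'-w) (count-XY-merged (head G D) (head-XY D)) ⟩
    indeg G' D' w + count XY                      ∎
    where open ≡-Reasoning
          into : Fin (suc k) → ℕ
          into v = count (λ e → XY e ∧ ⌊ head G D e ≟ v ⌋)

  count-XY-unmerged : ∀ (end : Fin m → Fin (suc k)) → (∀ e → XY e ≡ true → Merged (end e)) →
                      ∀ {v} → v ≢ x → v ≢ y → count (λ e → XY e ∧ ⌊ end e ≟ v ⌋) ≡ 0
  count-XY-unmerged end merged {v} v≢x v≢y = count-none _ none
    where none : ∀ e → (XY e ∧ ⌊ end e ≟ v ⌋) ≡ false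
          none e with XY e in h
          ... | false = refl
          ... | true with merged e h
          ...   | inj₁ end≡x = ≟-≢ (λ end≡v → v≢x (trans (sym end≡v) end≡x))
          ...   | inj₂ end≡y = ≟-≢ (λ end≡v → v≢y (trans (sym end≡v) end≡y))

  outdeg-unmerged : ∀ {D} → Extends D → ∀ {v} → v ≢ x → v ≢ y → outdeg G D v ≡ outdeg G' D' (π v)
  outdeg-unmerged {D} ext {v} v≢x v≢y = begin
    outdeg G D v          ≡⟨ outdeg-H+XY ext v ⟩
    outdeg H D' v + _     ≡⟨ cong (_+_ (outdeg H D' v)) (count-XY-unmerged (tail G D) (tail-XY D) v≢x v≢y) ⟩
    outdeg H D' v + 0     ≡⟨ +-identityʳ _ ⟩
    outdeg H D' v         ≡⟨ sym (outdeg'-unmerged v≢x v≢y) ⟩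
    outdeg G' D' (π v)    ∎
    where open ≡-Reasoning

  indeg-unmerged : ∀ {D} → Extends D → ∀ {v} → v ≢ x → v ≢ y → indeg G D v ≡ indeg G' D' (π v)
  indeg-unmerged {D} ext {v} v≢x v≢y = begin
    indeg G D v           ≡⟨ indeg-H+XY ext v ⟩
    indeg H D' v + _      ≡⟨ cong (_+_ (indeg H D' v)) (count-XY-unmerged (head G D) (head-XY D) v≢x v≢y) ⟩
    indeg H D' v + 0      ≡⟨ +-identityʳ _ ⟩
    indeg H D' v          ≡⟨ sym (indeg'-unmerged v≢x v≢y) ⟩
    indeg G' D' (π v)     ∎
    where open ≡-Reasoning

  -- The extension of D' orienting the edges of E(x,y) selected by s from x to y
  -- and the remaining ones from y to x.
  orient : (Fin m → Bool) → Orientation m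
  orient s e = if XY e then ⌊ proj₁ (G e) ≟ (if s e then x else y) ⌋ else extendAlong others D' e

  orient-extends : ∀ s → Extends (orient s)
  orient-extends s e' rewrite ι-not-XY e' = extendAlong-lookup D' (keep-unique (not ∘ XY)) e'

  orient-XY : ∀ s e → XY e ≡ true →
              tail G (orient s) e ≡ (if s e then x else y) × head G (orient s) e ≡ (if s e then y else x)
  orient-XY s e h = toward G (orient s) e (ends-differ (s e)) (ends (s e)) orient-e
    where
    orient-e : orient s e ≡ ⌊ proj₁ (G e) ≟ (if s e then x else y) ⌋
    orient-e = cong (λ b → if b then ⌊ proj₁ (G e) ≟ (if s e then x else y) ⌋ else extendAlong others D' e) h
    ends-differ : ∀ b → (if b then x else y) ≢ (if b then y else x)
    ends-differ true  = x≢y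
    ends-differ false = x≢y ∘ sym
    ends : ∀ b → G e ≡ ((if b then x else y) , (if b then y else x)) ⊎ G e ≡ ((if b then y else x) , (if b then x else y))
    ends true  = xy-ends e h
    ends false with xy-ends e h
    ... | inj₁ xy = inj₂ xy
    ... | inj₂ yx = inj₁ yx

  orient-out-x : ∀ s → count (λ e → XY e ∧ ⌊ tail G (orient s) e ≟ x ⌋) ≡ count (λ e → XY e ∧ s e)
  orient-out-x s = count-on-XY λ e h → trans (cong (λ a → ⌊ a ≟ x ⌋) (proj₁ (orient-XY s e h))) (leaves (s e))
    where leaves : ∀ b → ⌊ (if b then x else y) ≟ x ⌋ ≡ b
          leaves true  = ≟-refl x
          leaves false = ≟-≢ (x≢y ∘ sym)

  orient-in-x : ∀ s → count (λ e → XY e ∧ ⌊ head G (orient s) e ≟ x ⌋) ≡ count (λ e → XY e ∧ not (s e))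
  orient-in-x s = count-on-XY λ e h → trans (cong (λ a → ⌊ a ≟ x ⌋) (proj₂ (orient-XY s e h))) (enters (s e))
    where enters : ∀ b → ⌊ (if b then y else x) ≟ x ⌋ ≡ not b
          enters true  = ≟-≢ (x≢y ∘ sym)
          enters false = ≟-refl x

  orient-x→y : ∀ s → 1 ≤ count (λ e → XY e ∧ s e) → Reach G (orient s) x y
  orient-x→y s pos with count-witness _ pos
  ... | e , h with ∧-elim h
  ...   | xy , se with orient-XY s e xy
  ...     | t , hd = edge-walk e (trans t (if-true se)) (trans hd (if-true se))

  orient-y→x : ∀ s → 1 ≤ count (λ e → XY e ∧ not (s e)) → Reach G (orient s) y x
  orient-y→x s pos with count-witness _ pos
  ... | e , h with ∧-elim h
  ...   | xy , ¬se with orient-XY s e xy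
  ...     | t , hd = edge-walk e (trans t (if-false ¬se)) (trans hd (if-false ¬se))

  module _ {D : Orientation m} (ext : Extends D) (x→y : Reach G D x y) (y→x : Reach G D y x) where

    tail-lies-over : ∀ e' {a'} → tail G' D' e' ≡ a' → π (tail G D (ι e')) ≡ a'
    tail-lies-over e' t = trans (cong π (tail-sub G ι {D} ext e')) (trans (sym (tail-map π H D' e')) t)

    head-lies-over : ∀ e' → π (head G D (ι e')) ≡ head G' D' e'
    head-lies-over e' = trans (cong π (head-sub G ι {D} ext e')) (sym (head-map π H D' e'))

    merged-walk : ∀ {u v} → Merged u → Merged v → Reach G D u v
    merged-walk (inj₁ refl) (inj₁ refl) = here
    merged-walk (inj₁ refl) (inj₂ refl) = x→y
    merged-walk (inj₂ refl) (inj₁ refl) = y→x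
    merged-walk (inj₂ refl) (inj₂ refl) = here

    same-fibre-walk : ∀ {u v} → π u ≡ π v → Reach G D u v
    same-fibre-walk {u} {v} πu≡πv with π-fibre u v πu≡πv
    ... | inj₁ refl          = here
    ... | inj₂ (mu , mv)     = merged-walk mu mv

    lift : ∀ {a' b'} → Reach G' D' a' b' → ∀ {u v} → π u ≡ a' → π v ≡ b' → Reach G D u v
    lift here πu πv = same-fibre-walk (trans πu (sym πv))
    lift (step e' t r) πu πv =
      Reach-trans (same-fibre-walk (trans πu (sym (tail-lies-over e' t))))
                  (step (ι e') refl (lift r (head-lies-over e') πv))

    strongly-connected : StronglyConnected G' D' → StronglyConnected G D
    strongly-connected sc' u v = lift (sc' (π u) (π v)) refl refl

  ToMerged FromMerged : Fin (suc k) → Set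
  ToMerged u   = Reach H D' u x ⊎ Reach H D' u y
  FromMerged v = Reach H D' x v ⊎ Reach H D' y v

  to-self : ∀ {u} → Merged u → ToMerged u
  to-self (inj₁ refl) = inj₁ here
  to-self (inj₂ refl) = inj₂ here

  from-self : ∀ {v} → Merged v → FromMerged v
  from-self (inj₁ refl) = inj₁ here
  from-self (inj₂ refl) = inj₂ here

  to-prepend : ∀ {u a} → Reach H D' u a → ToMerged a → ToMerged u
  to-prepend r (inj₁ a→x) = inj₁ (Reach-trans r a→x)
  to-prepend r (inj₂ a→y) = inj₂ (Reach-trans r a→y)

  from-merged-walk : ∀ {a v} → Merged a → Reach H D' a v → FromMerged v
  from-merged-walk (inj₁ refl) r = inj₁ r
  from-merged-walk (inj₂ refl) r = inj₂ r

  lift-H : ∀ {a' b'} → Reach G' D' a' b' → ∀ {u v} → π u ≡ a' → π v ≡ b' →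
           Reach H D' u v ⊎ (ToMerged u × FromMerged v)
  lift-H here {u} {v} πu πv with π-fibre u v (trans πu (sym πv))
  ... | inj₁ refl      = inj₁ here
  ... | inj₂ (mu , mv) = inj₂ (to-self mu , from-self mv)
  lift-H (step e' t r) {u} πu πv
    with lift-H r (sym (head-map π H D' e')) πv
       | π-fibre (tail H D' e') u (trans (sym (tail-map π H D' e')) (trans t (sym πu)))
  ... | inj₁ r'          | inj₁ refl       = inj₁ (step e' refl r')
  ... | inj₂ (to , from) | inj₁ refl       = inj₂ (to-prepend (step e' refl here) to , from)
  ... | inj₁ r'          | inj₂ (mt , mu)  = inj₂ (to-self mu , from-merged-walk mt (step e' refl r'))
  ... | inj₂ (_ , from)  | inj₂ (_ , mu)   = inj₂ (to-self mu , from)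

  module _ (sc' : StronglyConnected G' D') where

    from-merged : ∀ v → FromMerged v
    from-merged v with lift-H (sc' w (π v)) {x} refl refl
    ... | inj₁ x→v      = inj₁ x→v
    ... | inj₂ (_ , from) = from

    to-merged : ∀ u → ToMerged u
    to-merged u with lift-H (sc' (π u) w) {u} {x} refl refl
    ... | inj₁ u→x      = inj₁ u→x
    ... | inj₂ (to , _) = to

    -- If H has no walk between x and y in either direction, the vertices
    -- reachable from x in H are separated from y by E(x,y) alone, so
    -- 4-edge-connectivity forces |E(x,y)| ≥ 4.
    module _ (¬x→y : ¬ Reach H D' x y) (¬y→x : ¬ Reach H D' y x) where
      open Reachability H D' using (Reach?)

      side : Fin (suc k) → Bool
      side v = does (Reach? x v)

      same-side : ∀ e' → side (tail H D' e') ≡ side (head H D' e')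
      same-side e' = does-agree (Reach? x (tail H D' e')) (Reach? x (head H D' e')) (Reach-snoc e') back
        where
        back : Reach H D' x (head H D' e') → Reach H D' x (tail H D' e')
        back x→h with from-merged (tail H D' e') | to-merged (head H D' e')
        ... | inj₁ x→t | _        = x→t
        ... | inj₂ y→t | inj₁ h→x = contradiction (Reach-trans (Reach-snoc e' y→t) h→x) ¬y→x
        ... | inj₂ _   | inj₂ h→y = contradiction (Reach-trans x→h h→y) ¬x→y

      cut-⊆-XY : cutSize G side ≤ count XY
      cut-⊆-XY = begin
        cutSize G side                         ≡⟨ count-H+XY cut ⟩
        count (cut ∘ ι) + count (λ e → XY e ∧ cut e) ≡⟨ cong (_+ count (λ e → XY e ∧ cut e)) (count-none (cut ∘ ι) (λ e' → xor-ends side (D' e') _ _ (same-side e'))) ⟩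
        count (λ e → XY e ∧ cut e)             ≤⟨ count-mono _ XY (λ e h → proj₁ (∧-elim h)) ⟩
        count XY                               ∎
        where open ≤-Reasoning
              cut : Fin m → Bool
              cut e = side (proj₁ (G e)) xor side (proj₂ (G e))

      side-x : side x ≡ true
      side-x = dec-true (Reach? x x) here

      side-y : side y ≡ false
      side-y = dec-false (Reach? x y) ¬x→y

      many-XY : EdgeConnected 4 G → 4 ≤ count XY
      many-XY connected = ≤-trans (connected side (x , side-x) (y , side-y)) cut-⊆-XY

  module Balance (β : Fin (suc k) → Fin 3) (β'-ok : IsBetaOrientation G' D' (β' β)) where

    Balanced : Orientation m → Fin (suc k) → Set
    Balanced D v = + 3 ∣ₛ net G D v ℤ.- + toℕ (β v)

    balanced-unmerged : ∀ {D} → Extends D → ∀ {v} → v ≢ x → v ≢ y → Balanced D v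
    balanced-unmerged ext v≢x v≢y =
      subst (λ z → + 3 ∣ₛ z) (sym (cong₂ (λ n b → n ℤ.- + toℕ b) net-eq (sym (β'-unmerged β v≢x v≢y)))) (∣ᵤ⇒∣ (β'-ok _))
      where net-eq = cong₂ (λ o i → + o ℤ.- + i) (outdeg-unmerged ext v≢x v≢y) (indeg-unmerged ext v≢x v≢y)

    balanced-y : ∀ {D} → Extends D → Balanced D x → Balanced D y
    balanced-y {D} ext balanced-x =
      balance-y (net G D x) (net G D y) (net G' D' w) (+ bx) (+ by) (+ M) (+ e) net-xy M≡ balanced-w balanced-x
      where
      bx by M e : ℕ
      bx = toℕ (β x)
      by = toℕ (β y)
      M  = toℕ ((bx + by) mod 3)
      e  = (bx + by) ℕ./ 3
      net-xy : net G D x ℤ.+ net G D y ≡ net G' D' w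
      net-xy = net-sum (outdeg G D x) (outdeg G D y) (indeg G D x) (indeg G D y) (outdeg G' D' w) (indeg G' D' w)
                 (count XY) (outdeg-merged {D} ext) (indeg-merged {D} ext)
      M≡ : + M ℤ.+ + e ℤ.* + 3 ≡ + bx ℤ.+ + by
      M≡ = begin
        + M ℤ.+ + e ℤ.* + 3  ≡⟨ cong (ℤ._+_ (+ M)) (ℤ.pos-* e 3) ⟨
        + (M + e * 3)        ≡⟨ cong (λ c → + (c + e * 3)) (toℕ-fromℕ< (m%n<n (bx + by) 3)) ⟩
        + ((bx + by) ℕ.% 3 + e * 3) ≡⟨ cong +_ (m≡m%n+[m/n]*n (bx + by) 3) ⟨
        + (bx + by)          ∎
        where open ≡-Reasoning
      balanced-w : + 3 ∣ₛ net G' D' w ℤ.- + M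
      balanced-w = subst (λ b → + 3 ∣ₛ net G' D' w ℤ.- + toℕ b) (β'-w β) (∣ᵤ⇒∣ (β'-ok w))

    -- The residue mod 3 that the number of edges of E(x,y) leaving x must have.
    A : ℤ
    A = + outdeg H D' x ℤ.- + indeg H D' x ℤ.- + toℕ (β x) ℤ.- + count XY

    residue : ℕ
    residue = A ℤ.%ℕ 3

    balanced-x : ∀ s r → count (λ e → XY e ∧ s e) ≡ residue + r * 3 → Balanced (orient s) x
    balanced-x s r p≡ =
      subst (λ z → + 3 ∣ₛ z ℤ.- b) (sym net-x)
        (divides (+ residue ℤ.+ A ℤ./ℕ 3 ℤ.+ + r ℤ.* + 2) (balance-x o i b (+ p) (+ q) (+ residue) (A ℤ./ℕ 3) (+ r) A≡ p≡ℤ))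
      where
      o i b : ℤ
      o = + outdeg H D' x
      i = + indeg H D' x
      b = + toℕ (β x)
      p q : ℕ
      p = count (λ e → XY e ∧ s e)
      q = count (λ e → XY e ∧ not (s e))
      p+q : p + q ≡ count XY
      p+q = count-split XY s
      A≡ : o ℤ.- i ℤ.- b ℤ.- (+ p ℤ.+ + q) ≡ + residue ℤ.+ A ℤ./ℕ 3 ℤ.* + 3
      A≡ = subst (λ t → o ℤ.- i ℤ.- b ℤ.- + t ≡ + residue ℤ.+ A ℤ./ℕ 3 ℤ.* + 3) (sym p+q) (ℤ.a≡a%ℕn+[a/ℕn]*n A 3)
      p≡ℤ : + p ≡ + residue ℤ.+ + r ℤ.* + 3
      p≡ℤ = trans (cong +_ p≡) (cong (ℤ._+_ (+ residue)) (ℤ.pos-* r 3))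
      net-x : net G (orient s) x ≡ + (outdeg H D' x + p) ℤ.- + (indeg H D' x + q)
      net-x = cong₂ (λ o i → + o ℤ.- + i)
                (trans (outdeg-H+XY (orient-extends s) x) (cong (_+_ _) (orient-out-x s)))
                (trans (indeg-H+XY (orient-extends s) x) (cong (_+_ _) (orient-in-x s)))

    balanced : ∀ s r → count (λ e → XY e ∧ s e) ≡ residue + r * 3 → IsBetaOrientation G (orient s) β
    balanced s r p≡ v with v ≟ x | v ≟ y
    ... | yes refl | _        = ∣⇒∣ᵤ (balanced-x s r p≡)
    ... | no _     | yes refl = ∣⇒∣ᵤ (balanced-y (orient-extends s) (balanced-x s r p≡))
    ... | no v≢x   | no v≢y   = ∣⇒∣ᵤ (balanced-unmerged (orient-extends s) v≢x v≢y)

    Extension : Set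
    Extension = Σ (Orientation m) (λ D → Extends D × StronglyConnected G D × IsBetaOrientation G D β)

    module Choice (3≤t : 3 ≤ count XY) (sc' : StronglyConnected G' D') where

      first : ℕ → Fin m → Bool
      first j = firstOf j XY

      leaving-x : ∀ j → j ≤ 3 → count (λ e → XY e ∧ first j e) ≡ j
      leaving-x j j≤3 = trans (count-firstOf j XY) (m≤n⇒m⊓n≡m (≤-trans j≤3 3≤t))

      entering-x : ∀ j → j ≤ 3 → j < count XY → 1 ≤ count (λ e → XY e ∧ not (first j e))
      entering-x j j≤3 j<t = positive (trans (cong (_+ count (λ e → XY e ∧ not (first j e))) (sym (leaving-x j j≤3))) (count-split XY (first j)))
        where positive : ∀ {q} → j + q ≡ count XY → 1 ≤ q
              positive {zero}  j+0≡t = contradiction (trans (sym (+-identityʳ j)) j+0≡t) (λ j≡t → <-irrefl j≡t j<t)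
              positive {suc q} _     = s≤s z≤n

      extension : ∀ j r → j ≤ 3 → j ≡ residue + r * 3 →
                  Reach G (orient (first j)) x y → Reach G (orient (first j)) y x → Extension
      extension j r j≤3 j≡ x→y y→x =
        orient (first j) , orient-extends (first j) ,
        strongly-connected (orient-extends (first j)) x→y y→x sc' ,
        balanced (first j) r (trans (leaving-x j j≤3) j≡)

      x→y-via : ∀ j → 1 ≤ j → j ≤ 3 → Reach G (orient (first j)) x y
      x→y-via j 1≤j j≤3 = orient-x→y (first j) (subst (1 ≤_) (sym (leaving-x j j≤3)) 1≤j)

      y→x-via : ∀ j → j ≤ 3 → j < count XY → Reach G (orient (first j)) y x
      y→x-via j j≤3 j<t = orient-y→x (first j) (entering-x j j≤3 j<t)

      via-H : ∀ j {u v} → Reach H D' u v → Reach G (orient (first j)) u v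
      via-H j = Reach-sub G ι (orient-extends (first j))

      open Reachability H D' using (Reach?)

      -- Residue 1 or 2: take j = 1 or 2, so E(x,y) has edges in both directions.
      -- Residue 0: take j = 0 if H has a walk x → y, else j = 3 if it has one
      -- y → x; if it has neither, |E(x,y)| ≥ 4 and j = 3 still leaves an edge y → x.
      choose : EdgeConnected 4 G → Extension
      choose connected with residue in res
      ... | 1 = extension 1 0 (s≤s z≤n) (sym (trans (+-identityʳ residue) res))
                  (x→y-via 1 ≤-refl (s≤s z≤n)) (y→x-via 1 (s≤s z≤n) (≤-trans (s≤s (s≤s z≤n)) 3≤t))
      ... | 2 = extension 2 0 (s≤s (s≤s z≤n)) (sym (trans (+-identityʳ residue) res))
                  (x→y-via 2 (s≤s z≤n) (s≤s (s≤s z≤n))) (y→x-via 2 (s≤s (s≤s z≤n)) 3≤t)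
      ... | suc (suc (suc _)) = contradiction (subst (ℕ._< 3) res (ℤ.n%ℕd<d A 3)) λ { (s≤s (s≤s (s≤s ()))) }
      ... | 0 with Reach? x y | Reach? y x
      ...   | yes x→y | _       = extension 0 0 z≤n (sym (trans (+-identityʳ residue) res))
                                    (via-H 0 x→y) (y→x-via 0 z≤n (≤-trans (s≤s z≤n) 3≤t))
      ...   | no _    | yes y→x = extension 3 1 ≤-refl (cong (_+ 3) (sym res))
                                    (x→y-via 3 (s≤s z≤n) ≤-refl) (via-H 3 y→x)
      ...   | no ¬x→y | no ¬y→x = extension 3 1 ≤-refl (cong (_+ 3) (sym res))
                                    (x→y-via 3 (s≤s z≤n) ≤-refl) (y→x-via 3 ≤-refl (many-XY sc' ¬x→y ¬y→x connected))

-- Lemma 2.4.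
lemma2p4 : ∀ {k m : ℕ} (G : Graph (suc k) m) (β : Fin (suc k) → Fin 3)
             (x y : Fin (suc k)) (x≢y : x ≢ y) →
             Loopless G → EdgeConnected 4 G → InZ3 β →
             3 ≤ count (isXY G x y) →
             (D' : Orientation (Contraction.m' G x y x≢y)) →
             StronglyConnected (Contraction.G' G x y x≢y) D' →
             IsBetaOrientation (Contraction.G' G x y x≢y) D' (Contraction.β' G x y x≢y β) →
             Σ (Orientation m) (λ D →
               (∀ e' → D (Contraction.ι G x y x≢y e') ≡ D' e') ×
               StronglyConnected G D × IsBetaOrientation G D β)
lemma2p4 G β x y x≢y _ connected _ 3≤t D' sc' β'-ok = Choice.choose 3≤t sc' connected
  where open Extension G x y x≢y D'
        open Balance β β'-ok
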